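{- Let $K$ be an imaginary quadratic field with $K\neq\mathbb{Q}(\sqrt{ -1}),\mathbb{Q}(\sqrt{ -3})$, $N$ a positive integer, $\mathfrak{n}=N\mathcal{O}_K$, $Q(x,y)=ax^2+bxy+cy^2\in\mathcal{Q}_N(d_K)$ and $C\in P_K(\mathfrak{n})/P_{K,1}(\mathfrak{n})\subseteq\mathrm{Cl}(\mathfrak{n})$. Then $C$ is the ray class of $(u\omega_Q+v)\mathcal{O}_K$ for some $u,v\in\mathbb{Z}$ with $\gcd(N,Q(v,-u))=1$.
   Context: $\mathcal{Q}_N(d_K)$ is the set of primitive positive definite forms $ax^2+bxy+cy^2\in\mathbb{Z}[x,y]$ with $b^2-4ac=d_K$ ($d_K$ the discriminant of $K$) and $\gcd(N,a)=1$; $\omega_Q=\frac{ -b+\sqrt{d_K}}{2a}$. $\mathrm{Cl}(\mathfrak{n})=I_K(\mathfrak{n})/P_{K,1}(\mathfrak{n})$ is the ray class group, where $I_K(\mathfrak{n})$ is the group of fractional ideals prime to $\mathfrak{n}$ and $P_{K,1}(\mathfrak{n})$ consists of principal ideals $\lambda\mathcal{O}_K$ with $\lambda\equiv^*1\pmod{\mathfrak{n}}$; $P_K(\mathfrak{n})$ is the subgroup of $I_K(\mathfrak{n})$ of principal fractional ideals prime to $\mathfrak{n}$. -}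

module Defs where

open import Data.Nat as ℕ using (ℕ)
open import Data.Integer as ℤ using (ℤ; +_; -[1+_]; ∣_∣)
open import Data.Integer.Divisibility as ℤD using ()
import Data.Nat.Divisibility as ℕD
open import Data.Integer.GCD using (gcd)
open import Data.Rational as ℚ using (ℚ; _/_; 0ℚ; 1ℚ)
open import Data.Product using (Σ; _×_; _,_; ∃; ∃-syntax)
open import Data.Sum using (_⊎_)
open import Relation.Binary.PropositionalEquality using (_≡_)

SquareFree : ℤ → Set
SquareFree m = ∀ (k : ℕ) → (k ℕ.* k) ℕD.∣ ∣ m ∣ → k ≡ 1

FundamentalDiscriminant : ℤ → Set
FundamentalDiscriminant d =
  (((+ 4) ℤD.∣ (d ℤ.- + 1)) × SquareFree d)
  ⊎ (∃[ m ] (d ≡ + 4 ℤ.* m)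
            × (((+ 4) ℤD.∣ (m ℤ.- + 2)) ⊎ ((+ 4) ℤD.∣ (m ℤ.- + 3)))
            × SquareFree m)

Qform : ℤ → ℤ → ℤ → ℤ → ℤ → ℤ
Qform a b c x y = a ℤ.* x ℤ.* x ℤ.+ b ℤ.* x ℤ.* y ℤ.+ c ℤ.* y ℤ.* y

-- Q = ax²+bxy+cy² ∈ 𝒬_N(d): primitive, positive definite, discriminant d,
-- and gcd(N, a) = 1.
InQN : ℕ → ℤ → ℤ → ℤ → ℤ → Set
InQN N d a b c =
  (gcd (gcd a b) c ≡ + 1)
  × (ℤ.0ℤ ℤ.< a) × (d ℤ.< ℤ.0ℤ)
  × (b ℤ.* b ℤ.- + 4 ℤ.* a ℤ.* c ≡ d)
  × (gcd (+ N) a ≡ + 1)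

-- The field K = ℚ(√d): an element x + y√d is the pair (x , y).

K : Set
K = ℚ × ℚ

_+K_ : K → K → K
(x₁ , y₁) +K (x₂ , y₂) = (x₁ ℚ.+ x₂ , y₁ ℚ.+ y₂)

mulK : ℤ → K → K → K
mulK d (x₁ , y₁) (x₂ , y₂) =
  (x₁ ℚ.* x₂ ℚ.+ (d / 1) ℚ.* y₁ ℚ.* y₂ , x₁ ℚ.* y₂ ℚ.+ y₁ ℚ.* x₂)

ratK : ℚ → K
ratK r = (r , 0ℚ)

intK : ℤ → K
intK m = ratK (m / 1)

1K : K
1K = ratK 1ℚ

-- reciprocal of an integer as a rational (junk value 0 at 0)
recipℤ : ℤ → ℚ
recipℤ (+ 0)        = 0ℚ
recipℤ (+ (ℕ.suc n)) = + 1 / ℕ.suc n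
recipℤ -[1+ n ]      = ℤ.-[1+ 0 ] / ℕ.suc n

ωQ : ℤ → ℤ → K
ωQ a b = ((ℤ.- b) / 1 ℚ.* recipℤ (+ 2 ℤ.* a) , recipℤ (+ 2 ℤ.* a))

-- The ring of integers 𝒪_K = ℤ[θ], θ = (d + √d)/2, for d a fundamental
-- discriminant.  An element m + nθ is the pair (m , n) of integers.

OK : Set
OK = ℤ × ℤ

-- embedding 𝒪_K → K :  m + nθ = (m + n d/2) + (n/2)√d
⟦_⟧ : OK → ℤ → K
⟦ m , n ⟧ d = (m / 1 ℚ.+ (n ℤ.* d) / 2 , n / 2)

-- α 𝒪_K + N 𝒪_K = 𝒪_K, i.e. the ideal α𝒪_K is prime to 𝔫 = N𝒪_K
CoprimeToN : ℤ → ℕ → OK → Set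
CoprimeToN d N α =
  ∃[ x ] ∃[ y ] (mulK d (⟦ x ⟧ d) (⟦ α ⟧ d) +K mulK d (⟦ y ⟧ d) (intK (+ N)) ≡ 1K)

CongModN : ℤ → ℕ → OK → OK → Set
CongModN d N ρ σ = ∃[ τ ] (⟦ ρ ⟧ d ≡ ⟦ σ ⟧ d +K mulK d (intK (+ N)) (⟦ τ ⟧ d))

IsUnitOK : ℤ → OK → Set
IsUnitOK d ε = ∃[ ε' ] (mulK d (⟦ ε ⟧ d) (⟦ ε' ⟧ d) ≡ 1K)

-- The principal ideal μ𝒪_K and the principal ideal (α/β)𝒪_K lie in the same
-- ray class modulo 𝔫 = N𝒪_K:  μ𝒪_K = γ (α/β) 𝒪_K for some γ ≡* 1 (mod 𝔫),
-- where γ = ρ/σ with ρ, σ ∈ 𝒪_K prime to 𝔫 and ρ ≡ σ (mod 𝔫); equality of the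
-- principal ideals μσβ𝒪_K = ρα𝒪_K means μσβ = ε ρ α for a unit ε of 𝒪_K.
SameRayClass : ℤ → ℕ → K → OK → OK → Set
SameRayClass d N μ α β =
  ∃[ ρ ] ∃[ σ ] ∃[ ε ]
    CoprimeToN d N ρ × CoprimeToN d N σ × CongModN d N ρ σ × IsUnitOK d ε
    × (mulK d (mulK d μ (⟦ σ ⟧ d)) (⟦ β ⟧ d)
        ≡ mulK d (mulK d (⟦ ε ⟧ d) (⟦ ρ ⟧ d)) (⟦ α ⟧ d))

-- Write 𝒪_K = ℤ[θ] with θ = (d + √d)/2, so θ² = dθ − k where 4k = d² − d, and pick h
-- with 2h = b + d; then a ω_Q = θ − h and Q(x, y) = a N(x − y ω_Q).  Given the class of
-- α/β with α, β prime to 𝔫, choose x with xβ ≡ 1 (mod 𝔫) and put ξ = αx = l₁ + l₂θ.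
-- Then ξβ ≡ α (mod 𝔫), so ξ𝒪_K lies in the ray class of α/β (with the unit 1), and
-- ξ = uω_Q + v for u = a l₂, v = l₁ + l₂h.  Finally Q(v, −u) = a N(ξ) is prime to N,
-- because ξ is invertible modulo 𝔫 (so N(ξ) is invertible modulo N) and gcd(N, a) = 1.

module Submission where

open import Defs
open import Level using (0ℓ)
open import Algebra.Bundles using (CommutativeRing)
open import Algebra.Bundles.Raw using (RawRing)
open import Algebra.Structures using (IsCommutativeRing)
import Algebra.Solver.Ring.AlmostCommutativeRing as ACR
import Algebra.Solver.Ring.Simple as RingSolver
open import Data.Nat as ℕ using (ℕ)
open import Data.Nat.Tactic.RingSolver using () renaming (solve-∀ to ℕ-solve-∀)
import Data.Nat.Coprimality as ℕC
import Data.Nat.Divisibility as ℕD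
open import Data.Integer as ℤ using (ℤ; +_; -[1+_]; ∣_∣)
open import Data.Integer.Coprimality using (Coprime)
import Data.Integer.DivMod as ℤDM
import Data.Integer.Divisibility.Signed as ℤD
open import Data.Integer.GCD using (gcd)
import Data.Integer.Properties as ℤP
open import Data.Integer.Solver using () renaming (module +-*-Solver to ℤ-Solver)
open import Data.Integer.Tactic.RingSolver using (solve-∀) renaming (solve to ℤ-solve)
open import Data.Rational as ℚ using (ℚ; _/_; 0ℚ)
import Data.Rational.Properties as ℚP
open import Data.Rational.Solver using () renaming (module +-*-Solver to ℚ-Solver)
import Data.Rational.Unnormalised as ℚᵘ
import Data.Rational.Unnormalised.Properties as ℚᵘP
open import Data.List using (_∷_; [])
open import Data.Product using (_×_; _,_; ∃-syntax; proj₁; proj₂)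
open import Data.Product.Properties using (≡-dec)
open import Data.Sum using (_⊎_; inj₁; inj₂)
open import Relation.Binary.PropositionalEquality

toℚ : ℤ → ℚ
toℚ i = i / 1

½ : ℚ
½ = + 1 / 2

private
  toℚᵘ-toℚ : ∀ i → ℚ.toℚᵘ (toℚ i) ℚᵘ.≃ ℚᵘ.mkℚᵘ i 0
  toℚᵘ-toℚ i = ℚP.toℚᵘ-fromℚᵘ (ℚᵘ.mkℚᵘ i 0)

  toℚ-lift : ∀ i {p} → ℚᵘ.mkℚᵘ i 0 ℚᵘ.≃ ℚ.toℚᵘ p → toℚ i ≡ p
  toℚ-lift i eq = ℚP.toℚᵘ-injective (ℚᵘP.≃-trans (toℚᵘ-toℚ i) eq)

toℚ-homo-+ : ∀ i j → toℚ (i ℤ.+ j) ≡ toℚ i ℚ.+ toℚ j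
toℚ-homo-+ i j = toℚ-lift (i ℤ.+ j) (begin
  ℚᵘ.mkℚᵘ (i ℤ.+ j) 0                       ≈⟨ ℚᵘ.*≡* (cross-mult i j) ⟩
  ℚᵘ.mkℚᵘ i 0 ℚᵘ.+ ℚᵘ.mkℚᵘ j 0              ≈⟨ ℚᵘP.+-cong (toℚᵘ-toℚ i) (toℚᵘ-toℚ j) ⟨
  ℚ.toℚᵘ (toℚ i) ℚᵘ.+ ℚ.toℚᵘ (toℚ j)        ≈⟨ ℚP.toℚᵘ-homo-+ (toℚ i) (toℚ j) ⟨
  ℚ.toℚᵘ (toℚ i ℚ.+ toℚ j)                  ∎)
  where
  open ℚᵘP.≃-Reasoning
  cross-mult : ∀ i j → (i ℤ.+ j) ℤ.* + 1 ≡ (i ℤ.* + 1 ℤ.+ j ℤ.* + 1) ℤ.* + 1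
  cross-mult = solve-∀

toℚ-homo-* : ∀ i j → toℚ (i ℤ.* j) ≡ toℚ i ℚ.* toℚ j
toℚ-homo-* i j = toℚ-lift (i ℤ.* j) (begin
  ℚᵘ.mkℚᵘ (i ℤ.* j) 0                       ≈⟨ ℚᵘP.*-cong (toℚᵘ-toℚ i) (toℚᵘ-toℚ j) ⟨
  ℚ.toℚᵘ (toℚ i) ℚᵘ.* ℚ.toℚᵘ (toℚ j)        ≈⟨ ℚP.toℚᵘ-homo-* (toℚ i) (toℚ j) ⟨
  ℚ.toℚᵘ (toℚ i ℚ.* toℚ j)                  ∎)
  where open ℚᵘP.≃-Reasoning

toℚ-homo‿- : ∀ i → toℚ (ℤ.- i) ≡ ℚ.- toℚ i
toℚ-homo‿- i = toℚ-lift (ℤ.- i) (begin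
  ℚᵘ.- ℚᵘ.mkℚᵘ i 0                          ≈⟨ ℚᵘP.-‿cong (toℚᵘ-toℚ i) ⟨
  ℚᵘ.- ℚ.toℚᵘ (toℚ i)                       ≈⟨ ℚP.toℚᵘ-homo‿- (toℚ i) ⟨
  ℚ.toℚᵘ (ℚ.- toℚ i)                        ∎)
  where open ℚᵘP.≃-Reasoning

toℚ-homo-− : ∀ i j → toℚ (i ℤ.- j) ≡ toℚ i ℚ.- toℚ j
toℚ-homo-− i j = trans (toℚ-homo-+ i (ℤ.- j)) (cong (toℚ i ℚ.+_) (toℚ-homo‿- j))

toℚ-injective : ∀ {i j} → toℚ i ≡ toℚ j → i ≡ j
toℚ-injective {i} {j} eq
  with ℚᵘ.*≡* i*1≡j*1 ← ℚᵘP.≃-trans (ℚᵘP.≃-sym (toℚᵘ-toℚ i)) (ℚᵘP.≃-trans (ℚP.toℚᵘ-cong eq) (toℚᵘ-toℚ j))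
  = trans (sym (ℤP.*-identityʳ i)) (trans i*1≡j*1 (ℤP.*-identityʳ j))

i/2≡toℚ[i]*½ : ∀ i → i / 2 ≡ toℚ i ℚ.* ½
i/2≡toℚ[i]*½ i = ℚP.toℚᵘ-injective (begin
  ℚ.toℚᵘ (i / 2)                            ≈⟨ ℚP.toℚᵘ-fromℚᵘ (ℚᵘ.mkℚᵘ i 1) ⟩
  ℚᵘ.mkℚᵘ i 1                               ≈⟨ ℚᵘ.*≡* (cross-mult i) ⟩
  ℚᵘ.mkℚᵘ i 0 ℚᵘ.* ℚ.toℚᵘ ½                 ≈⟨ ℚᵘP.*-cong (toℚᵘ-toℚ i) ℚᵘP.≃-refl ⟨
  ℚ.toℚᵘ (toℚ i) ℚᵘ.* ℚ.toℚᵘ ½              ≈⟨ ℚP.toℚᵘ-homo-* (toℚ i) ½ ⟨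
  ℚ.toℚᵘ (toℚ i ℚ.* ½)                      ∎)
  where
  open ℚᵘP.≃-Reasoning
  cross-mult : ∀ i → i ℤ.* + 2 ≡ (i ℤ.* + 1) ℤ.* + 2
  cross-mult = solve-∀

-- recipℤ (2a) computes to the normalised fraction 1 / (n + 1 · (n + 1) + 1).
toℚ[a]*recip[2a]≡½ : ∀ n → toℚ (+ ℕ.suc n) ℚ.* recipℤ (+ 2 ℤ.* + ℕ.suc n) ≡ ½
toℚ[a]*recip[2a]≡½ n = ℚP.toℚᵘ-injective (begin
  ℚ.toℚᵘ (toℚ a ℚ.* recipℤ (+ 2 ℤ.* a))                    ≈⟨ ℚP.toℚᵘ-homo-* (toℚ a) (recipℤ (+ 2 ℤ.* a)) ⟩
  ℚ.toℚᵘ (toℚ a) ℚᵘ.* ℚ.toℚᵘ (recipℤ (+ 2 ℤ.* a))          ≈⟨ ℚᵘP.*-cong (toℚᵘ-toℚ a) (ℚP.toℚᵘ-fromℚᵘ (ℚᵘ.mkℚᵘ (+ 1) (n ℕ.+ 1 ℕ.* ℕ.suc n))) ⟩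
  ℚᵘ.mkℚᵘ a 0 ℚᵘ.* ℚᵘ.mkℚᵘ (+ 1) (n ℕ.+ 1 ℕ.* ℕ.suc n)    ≈⟨ ℚᵘ.*≡* (cong +_ (cross-mult n)) ⟩
  ℚ.toℚᵘ ½                                                 ∎)
  where
  open ℚᵘP.≃-Reasoning
  a : ℤ
  a = + ℕ.suc n
  cross-mult : ∀ n → (ℕ.suc n ℕ.* 1) ℕ.* 2 ≡ 1 ℕ.* (1 ℕ.* ℕ.suc (n ℕ.+ 1 ℕ.* ℕ.suc n))
  cross-mult = ℕ-solve-∀

gcd≡1⇒coprime : ∀ i j → gcd i j ≡ + 1 → Coprime i j
gcd≡1⇒coprime _ _ eq = ℕC.gcd≡1⇒coprime (ℤP.+-injective eq)

coprime⇒gcd≡1 : ∀ i j → Coprime i j → gcd i j ≡ + 1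
coprime⇒gcd≡1 _ _ i⊥j = cong +_ (ℕC.coprime⇒gcd≡1 i⊥j)

Bézout⇒coprime : ∀ m n s t → s ℤ.* m ℤ.+ n ℤ.* t ≡ + 1 → Coprime n m
Bézout⇒coprime m n s t eq {i} (i∣n , i∣m) = ℕD.∣1⇒≡1 (ℤD.∣⇒∣ᵤ (subst (+ i ℤD.∣_) eq
  (ℤD.∣m∣n⇒∣m+n (ℤD.∣n⇒∣m*n s (ℤD.∣ᵤ⇒∣ {+ i} {m} i∣m)) (ℤD.∣m⇒∣m*n t (ℤD.∣ᵤ⇒∣ {+ i} {n} i∣n)))))

coprime-* : ∀ n a m → Coprime n a → Coprime n m → Coprime n (a ℤ.* m)
coprime-* n a m n⊥a n⊥m {i} (i∣n , i∣am) =
  n⊥m (i∣n , ℕC.coprime-divisor i⊥a (subst (i ℕD.∣_) (ℤP.abs-* a m) i∣am))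
  where
  i⊥a : ℕC.Coprime i ∣ a ∣
  i⊥a (j∣i , j∣a) = n⊥a (ℕD.∣-trans j∣i i∣n , j∣a)

-- The order ℤ[θ], θ² = dθ − k

-- Stated over an arbitrary raw ring so that the ring solver can be handed the same
-- formula on polynomials.
θ-mul : ∀ {c ℓ} (R : RawRing c ℓ) → let open RawRing R in
        Carrier → Carrier → Carrier × Carrier → Carrier × Carrier → Carrier × Carrier
θ-mul R d k (m , n) (m' , n') = (m * m' + - (n * n' * k) , m * n' + n * m' + n * n' * d)
  where open RawRing R

θ-norm : ∀ {c ℓ} (R : RawRing c ℓ) → let open RawRing R in
         Carrier → Carrier → Carrier × Carrier → Carrier
θ-norm R d k (m , n) = m * m + m * n * d + n * n * k
  where open RawRing R

polynomialRawRing : ℕ → RawRing 0ℓ 0ℓ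
polynomialRawRing n = record
  { Carrier = Polynomial n ; _≈_ = _≡_
  ; _+_ = _:+_ ; _*_ = _:*_ ; -_ = :-_ ; 0# = con (+ 0) ; 1# = con (+ 1) }
  where open ℤ-Solver

module ℤ[θ] (d k : ℤ) where
  infixl 6 _+_
  infixl 7 _*_
  infix  8 -_

  _+_ : OK → OK → OK
  (m , n) + (m' , n') = (m ℤ.+ m' , n ℤ.+ n')

  -_ : OK → OK
  - (m , n) = (ℤ.- m , ℤ.- n)

  _*_ : OK → OK → OK
  _*_ = θ-mul ℤ.+-*-rawRing d k

  ι : ℤ → OK
  ι i = (i , + 0)

  0# 1# : OK
  0# = ι (+ 0)
  1# = ι (+ 1)

  norm : OK → ℤ
  norm = θ-norm ℤ.+-*-rawRing d k

  private
    open ℤ-Solver using (Polynomial; solve; _:=_; con; _:+_; _:*_)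

    _⊛⟨_,_⟩_ : ∀ {n} → Polynomial n × Polynomial n → Polynomial n → Polynomial n →
               Polynomial n × Polynomial n → Polynomial n × Polynomial n
    p ⊛⟨ D , K ⟩ q = θ-mul (polynomialRawRing _) D K p q

    normᴾ : ∀ {n} → Polynomial n → Polynomial n → Polynomial n × Polynomial n → Polynomial n
    normᴾ = θ-norm (polynomialRawRing _)

    _⊕_ : ∀ {n} → Polynomial n × Polynomial n → Polynomial n × Polynomial n → Polynomial n × Polynomial n
    (m , n) ⊕ (m' , n') = (m :+ m' , n :+ n')

  *-assoc : ∀ p q r → (p * q) * r ≡ p * (q * r)
  *-assoc (a , b) (c , e) (f , g) = cong₂ _,_
    (solve 8 (λ D K a b c e f g → proj₁ (((a , b) ⊛⟨ D , K ⟩ (c , e)) ⊛⟨ D , K ⟩ (f , g))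
                               := proj₁ ((a , b) ⊛⟨ D , K ⟩ ((c , e) ⊛⟨ D , K ⟩ (f , g)))) refl d k a b c e f g)
    (solve 8 (λ D K a b c e f g → proj₂ (((a , b) ⊛⟨ D , K ⟩ (c , e)) ⊛⟨ D , K ⟩ (f , g))
                               := proj₂ ((a , b) ⊛⟨ D , K ⟩ ((c , e) ⊛⟨ D , K ⟩ (f , g)))) refl d k a b c e f g)

  *-comm : ∀ p q → p * q ≡ q * p
  *-comm (a , b) (c , e) = cong₂ _,_
    (solve 6 (λ D K a b c e → proj₁ ((a , b) ⊛⟨ D , K ⟩ (c , e)) := proj₁ ((c , e) ⊛⟨ D , K ⟩ (a , b))) refl d k a b c e)
    (solve 6 (λ D K a b c e → proj₂ ((a , b) ⊛⟨ D , K ⟩ (c , e)) := proj₂ ((c , e) ⊛⟨ D , K ⟩ (a , b))) refl d k a b c e)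

  *-identityˡ : ∀ p → 1# * p ≡ p
  *-identityˡ (a , b) = cong₂ _,_
    (solve 4 (λ D K a b → proj₁ ((con (+ 1) , con (+ 0)) ⊛⟨ D , K ⟩ (a , b)) := a) refl d k a b)
    (solve 4 (λ D K a b → proj₂ ((con (+ 1) , con (+ 0)) ⊛⟨ D , K ⟩ (a , b)) := b) refl d k a b)

  *-distribˡ-+ : ∀ p q r → p * (q + r) ≡ p * q + p * r
  *-distribˡ-+ (a , b) (c , e) (f , g) = cong₂ _,_
    (solve 8 (λ D K a b c e f g → proj₁ ((a , b) ⊛⟨ D , K ⟩ ((c , e) ⊕ (f , g)))
                               := proj₁ (((a , b) ⊛⟨ D , K ⟩ (c , e)) ⊕ ((a , b) ⊛⟨ D , K ⟩ (f , g)))) refl d k a b c e f g)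
    (solve 8 (λ D K a b c e f g → proj₂ ((a , b) ⊛⟨ D , K ⟩ ((c , e) ⊕ (f , g)))
                               := proj₂ (((a , b) ⊛⟨ D , K ⟩ (c , e)) ⊕ ((a , b) ⊛⟨ D , K ⟩ (f , g)))) refl d k a b c e f g)

  isCommutativeRing : IsCommutativeRing _≡_ _+_ _*_ -_ 0# 1#
  isCommutativeRing = record
    { isRing = record
      { +-isAbelianGroup = record
        { isGroup = record
          { isMonoid = record
            { isSemigroup = record
              { isMagma = record { isEquivalence = isEquivalence ; ∙-cong = cong₂ _+_ }
              ; assoc = λ (a , b) (c , e) (f , g) → cong₂ _,_ (ℤP.+-assoc a c f) (ℤP.+-assoc b e g) }
            ; identity = (λ (a , b) → cong₂ _,_ (ℤP.+-identityˡ a) (ℤP.+-identityˡ b))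
                       , (λ (a , b) → cong₂ _,_ (ℤP.+-identityʳ a) (ℤP.+-identityʳ b)) }
          ; inverse = (λ (a , b) → cong₂ _,_ (ℤP.+-inverseˡ a) (ℤP.+-inverseˡ b))
                    , (λ (a , b) → cong₂ _,_ (ℤP.+-inverseʳ a) (ℤP.+-inverseʳ b))
          ; ⁻¹-cong = cong -_ }
        ; comm = λ (a , b) (c , e) → cong₂ _,_ (ℤP.+-comm a c) (ℤP.+-comm b e) }
      ; *-cong = cong₂ _*_
      ; *-assoc = *-assoc
      ; *-identity = *-identityˡ , λ p → trans (*-comm p 1#) (*-identityˡ p)
      ; distrib = *-distribˡ-+
                , λ p q r → trans (*-comm (q + r) p) (trans (*-distribˡ-+ p q r) (cong₂ _+_ (*-comm p q) (*-comm p r))) }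
    ; *-comm = *-comm }

  commutativeRing : CommutativeRing 0ℓ 0ℓ
  commutativeRing = record { isCommutativeRing = isCommutativeRing }

  norm-* : ∀ p q → norm (p * q) ≡ norm p ℤ.* norm q
  norm-* (a , b) (c , e) =
    solve 6 (λ D K a b c e → normᴾ D K ((a , b) ⊛⟨ D , K ⟩ (c , e)) := normᴾ D K (a , b) :* normᴾ D K (c , e))
      refl d k a b c e

  norm-+*ι : ∀ n w y → ∃[ t ] norm (w + y * ι n) ≡ norm w ℤ.+ n ℤ.* t
  norm-+*ι n (w₁ , w₂) (y₁ , y₂) =
    + 2 ℤ.* w₁ ℤ.* y₁ ℤ.+ (w₁ ℤ.* y₂ ℤ.+ w₂ ℤ.* y₁) ℤ.* d ℤ.+ + 2 ℤ.* w₂ ℤ.* y₂ ℤ.* k ℤ.+ n ℤ.* norm (y₁ , y₂) ,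
    solve 7 (λ D K n w₁ w₂ y₁ y₂ →
        normᴾ D K ((w₁ , w₂) ⊕ ((y₁ , y₂) ⊛⟨ D , K ⟩ (n , con (+ 0))))
     := normᴾ D K (w₁ , w₂) :+ n :* (con (+ 2) :* w₁ :* y₁ :+ (w₁ :* y₂ :+ w₂ :* y₁) :* D
                                     :+ con (+ 2) :* w₂ :* y₂ :* K :+ n :* normᴾ D K (y₁ , y₂)))
      refl d k n w₁ w₂ y₁ y₂

module Residues (d k : ℤ) where
  open ℤ[θ] d k

  private
    module 𝒪-Solver = RingSolver (ACR.fromCommutativeRing commutativeRing) (≡-dec ℤP._≟_ ℤP._≟_)

  InvertibleMod : OK → OK → Set
  InvertibleMod n z = ∃[ x ] ∃[ y ] x * z + y * n ≡ 1#

  invertibleMod-* : ∀ {n p q} → InvertibleMod n p → InvertibleMod n q → InvertibleMod n (p * q)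
  invertibleMod-* {n} {p} {q} (x , y , xp+yn≡1) (x' , y' , x'q+y'n≡1) =
    x * x' , y * (x' * q) + (x * p) * y' + (y * y') * n , (begin
      (x * x') * (p * q) + (y * (x' * q) + (x * p) * y' + (y * y') * n) * n
        ≡⟨ cong (_+ (y * (x' * q) + (x * p) * y' + (y * y') * n) * n)
             (solve 4 (λ x x' p q → (x :* x') :* (p :* q) := (x :* p) :* (x' :* q)) refl x x' p q) ⟩
      (x * p) * (x' * q) + (y * (x' * q) + (x * p) * y' + (y * y') * n) * n
        ≡⟨ solve 5 (λ A B y y' n → A :* B :+ (y :* B :+ A :* y' :+ (y :* y') :* n) :* n
                                := (A :+ y :* n) :* (B :+ y' :* n)) refl (x * p) (x' * q) y y' n ⟩
      (x * p + y * n) * (x' * q + y' * n)  ≡⟨ cong₂ _*_ xp+yn≡1 x'q+y'n≡1 ⟩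
      1# * 1#                              ≡⟨ *-identityˡ 1# ⟩
      1#                                   ∎)
    where
    open ≡-Reasoning
    open 𝒪-Solver using (solve; _:+_; _:*_; _:=_)

  -- ξ = α x where x β ≡ 1 (mod n)
  quotientMod : ∀ {n α β} → InvertibleMod n α → InvertibleMod n β →
                ∃[ ξ ] InvertibleMod n ξ × ∃[ τ ] ξ * β ≡ α + n * τ
  quotientMod {n} {α} {β} α-inv (x , y , xβ+yn≡1) =
    α * x , invertibleMod-* α-inv (β , y , trans (cong (_+ y * n) (*-comm β x)) xβ+yn≡1) ,
    - (α * y) , (begin
      (α * x) * β                              ≡⟨ solve 5 (λ α x β y n →
                                                     (α :* x) :* β := α :* (x :* β :+ y :* n) :+ n :* (:- (α :* y)))
                                                   refl α x β y n ⟩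
      α * (x * β + y * n) + n * - (α * y)      ≡⟨ cong (λ e → α * e + n * - (α * y)) xβ+yn≡1 ⟩
      α * 1# + n * - (α * y)                   ≡⟨ cong (_+ n * - (α * y)) (trans (*-comm α 1#) (*-identityˡ α)) ⟩
      α + n * - (α * y)                        ∎)
    where
    open ≡-Reasoning
    open 𝒪-Solver using (solve; _:+_; _:*_; _:=_; :-_)

  invertibleMod⇒coprime-norm : ∀ {n z} → InvertibleMod (ι n) z → Coprime n (norm z)
  invertibleMod⇒coprime-norm {n} {z} (x , y , xz+yn≡1) =
    let t , eq = norm-+*ι n (x * z) y in
    Bézout⇒coprime (norm z) n (norm x) t (begin
      norm x ℤ.* norm z ℤ.+ n ℤ.* t    ≡⟨ cong (ℤ._+ n ℤ.* t) (norm-* x z) ⟨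
      norm (x * z) ℤ.+ n ℤ.* t         ≡⟨ eq ⟨
      norm (x * z + y * ι n)           ≡⟨ cong norm xz+yn≡1 ⟩
      norm 1#                          ≡⟨⟩
      + 1                              ∎)
    where open ≡-Reasoning

-- θ = (d + √d)/2 has trace d and norm k, i.e. θ² = dθ − k.
IsNormθ : ℤ → ℤ → Set
IsNormθ d k = + 4 ℤ.* k ≡ d ℤ.* d ℤ.- d

⟦⟧-components : ∀ d m n → ⟦ m , n ⟧ d ≡ (toℚ m ℚ.+ toℚ n ℚ.* toℚ d ℚ.* ½ , toℚ n ℚ.* ½)
⟦⟧-components d m n = cong₂ _,_
  (cong (toℚ m ℚ.+_) (trans (i/2≡toℚ[i]*½ (n ℤ.* d)) (cong (ℚ._* ½) (toℚ-homo-* n d))))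
  (i/2≡toℚ[i]*½ n)

module Embedding (d k : ℤ) (4k≡d²-d : IsNormθ d k) where
  open ℤ[θ] d k
  open Residues d k
  open ℚ-Solver using (solve; _:+_; _:*_; _:-_; _:=_; con)

  private
    D : ℚ
    D = toℚ d

  toℚ-k : toℚ k ≡ (D ℚ.* D ℚ.- D) ℚ.* ½ ℚ.* ½
  toℚ-k = begin
    toℚ k                                   ≡⟨ solve 1 (λ K → K := (con (toℚ (+ 4)) :* K) :* con ½ :* con ½) refl (toℚ k) ⟩
    (toℚ (+ 4) ℚ.* toℚ k) ℚ.* ½ ℚ.* ½        ≡⟨ cong (λ t → t ℚ.* ½ ℚ.* ½) (toℚ-homo-* (+ 4) k) ⟨
    toℚ (+ 4 ℤ.* k) ℚ.* ½ ℚ.* ½             ≡⟨ cong (λ t → toℚ t ℚ.* ½ ℚ.* ½) 4k≡d²-d ⟩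
    toℚ (d ℤ.* d ℤ.- d) ℚ.* ½ ℚ.* ½         ≡⟨ cong (λ t → t ℚ.* ½ ℚ.* ½)
                                                  (trans (toℚ-homo-− (d ℤ.* d) d) (cong (ℚ._- D) (toℚ-homo-* d d))) ⟩
    (D ℚ.* D ℚ.- D) ℚ.* ½ ℚ.* ½             ∎
    where open ≡-Reasoning

  ⟦⟧-homo-+ : ∀ p q → ⟦ p + q ⟧ d ≡ ⟦ p ⟧ d +K ⟦ q ⟧ d
  ⟦⟧-homo-+ (m , n) (m' , n') = begin
    ⟦ m ℤ.+ m' , n ℤ.+ n' ⟧ d
      ≡⟨ ⟦⟧-components d (m ℤ.+ m') (n ℤ.+ n') ⟩
    (toℚ (m ℤ.+ m') ℚ.+ toℚ (n ℤ.+ n') ℚ.* D ℚ.* ½ , toℚ (n ℤ.+ n') ℚ.* ½)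
      ≡⟨ cong₂ (λ x y → (x ℚ.+ y ℚ.* D ℚ.* ½ , y ℚ.* ½)) (toℚ-homo-+ m m') (toℚ-homo-+ n n') ⟩
    ((M ℚ.+ M') ℚ.+ (N ℚ.+ N') ℚ.* D ℚ.* ½ , (N ℚ.+ N') ℚ.* ½)
      ≡⟨ cong₂ _,_
           (solve 5 (λ M N M' N' D → (M :+ M') :+ (N :+ N') :* D :* con ½
                                  := (M :+ N :* D :* con ½) :+ (M' :+ N' :* D :* con ½)) refl M N M' N' D)
           (solve 2 (λ N N' → (N :+ N') :* con ½ := N :* con ½ :+ N' :* con ½) refl N N') ⟩
    (M ℚ.+ N ℚ.* D ℚ.* ½ , N ℚ.* ½) +K (M' ℚ.+ N' ℚ.* D ℚ.* ½ , N' ℚ.* ½)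
      ≡⟨ cong₂ _+K_ (⟦⟧-components d m n) (⟦⟧-components d m' n') ⟨
    ⟦ m , n ⟧ d +K ⟦ m' , n' ⟧ d ∎
    where
    open ≡-Reasoning
    M N M' N' : ℚ
    M = toℚ m ; N = toℚ n ; M' = toℚ m' ; N' = toℚ n'

  ⟦⟧-homo-* : ∀ p q → ⟦ p * q ⟧ d ≡ mulK d (⟦ p ⟧ d) (⟦ q ⟧ d)
  ⟦⟧-homo-* (m , n) (m' , n') = begin
    ⟦ m ℤ.* m' ℤ.- n ℤ.* n' ℤ.* k , P ⟧ d
      ≡⟨ ⟦⟧-components d (m ℤ.* m' ℤ.- n ℤ.* n' ℤ.* k) P ⟩
    (toℚ (m ℤ.* m' ℤ.- n ℤ.* n' ℤ.* k) ℚ.+ toℚ P ℚ.* D ℚ.* ½ , toℚ P ℚ.* ½)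
      ≡⟨ cong₂ (λ x y → (x ℚ.+ y ℚ.* D ℚ.* ½ , y ℚ.* ½)) toℚ[mm'-nn'k] toℚ[P] ⟩
    (M ℚ.* M' ℚ.- N ℚ.* N' ℚ.* toℚ k ℚ.+ PP ℚ.* D ℚ.* ½ , PP ℚ.* ½)
      ≡⟨ cong (λ K → (M ℚ.* M' ℚ.- N ℚ.* N' ℚ.* K ℚ.+ PP ℚ.* D ℚ.* ½ , PP ℚ.* ½)) toℚ-k ⟩
    ((M ℚ.* M' ℚ.- N ℚ.* N' ℚ.* ((D ℚ.* D ℚ.- D) ℚ.* ½ ℚ.* ½)) ℚ.+ PP ℚ.* D ℚ.* ½ , PP ℚ.* ½)
      ≡⟨ cong₂ _,_
           (solve 5 (λ M N M' N' D →
                (M :* M' :- N :* N' :* ((D :* D :- D) :* con ½ :* con ½)) :+ (M :* N' :+ N :* M' :+ N :* N' :* D) :* D :* con ½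
             := (M :+ N :* D :* con ½) :* (M' :+ N' :* D :* con ½) :+ D :* (N :* con ½) :* (N' :* con ½)) refl M N M' N' D)
           (solve 5 (λ M N M' N' D →
                (M :* N' :+ N :* M' :+ N :* N' :* D) :* con ½
             := (M :+ N :* D :* con ½) :* (N' :* con ½) :+ (N :* con ½) :* (M' :+ N' :* D :* con ½)) refl M N M' N' D) ⟩
    mulK d (M ℚ.+ N ℚ.* D ℚ.* ½ , N ℚ.* ½) (M' ℚ.+ N' ℚ.* D ℚ.* ½ , N' ℚ.* ½)
      ≡⟨ cong₂ (mulK d) (⟦⟧-components d m n) (⟦⟧-components d m' n') ⟨
    mulK d (⟦ m , n ⟧ d) (⟦ m' , n' ⟧ d) ∎
    where
    open ≡-Reasoning
    M N M' N' : ℚ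
    M = toℚ m ; N = toℚ n ; M' = toℚ m' ; N' = toℚ n'
    P : ℤ
    P = m ℤ.* n' ℤ.+ n ℤ.* m' ℤ.+ n ℤ.* n' ℤ.* d
    PP : ℚ
    PP = M ℚ.* N' ℚ.+ N ℚ.* M' ℚ.+ N ℚ.* N' ℚ.* D
    toℚ[mm'-nn'k] : toℚ (m ℤ.* m' ℤ.- n ℤ.* n' ℤ.* k) ≡ M ℚ.* M' ℚ.- N ℚ.* N' ℚ.* toℚ k
    toℚ[mm'-nn'k] = trans (toℚ-homo-− (m ℤ.* m') (n ℤ.* n' ℤ.* k))
      (cong₂ ℚ._-_ (toℚ-homo-* m m') (trans (toℚ-homo-* (n ℤ.* n') k) (cong (ℚ._* toℚ k) (toℚ-homo-* n n'))))
    toℚ[P] : toℚ P ≡ PP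
    toℚ[P] = trans (toℚ-homo-+ (m ℤ.* n' ℤ.+ n ℤ.* m') (n ℤ.* n' ℤ.* d))
      (cong₂ ℚ._+_ (trans (toℚ-homo-+ (m ℤ.* n') (n ℤ.* m')) (cong₂ ℚ._+_ (toℚ-homo-* m n') (toℚ-homo-* n m')))
                   (trans (toℚ-homo-* (n ℤ.* n') d) (cong (ℚ._* D) (toℚ-homo-* n n'))))

  ⟦ι⟧ : ∀ i → ⟦ ι i ⟧ d ≡ intK i
  ⟦ι⟧ i = cong₂ _,_ (ℚP.+-identityʳ (toℚ i)) refl

  ⟦⟧-injective : ∀ {p q} → ⟦ p ⟧ d ≡ ⟦ q ⟧ d → p ≡ q
  ⟦⟧-injective {m , n} {m' , n'} ⟦p⟧≡⟦q⟧ = cong₂ _,_ m≡m' n≡n'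
    where
    open ≡-Reasoning
    components≡ : (toℚ m ℚ.+ toℚ n ℚ.* D ℚ.* ½ , toℚ n ℚ.* ½) ≡ (toℚ m' ℚ.+ toℚ n' ℚ.* D ℚ.* ½ , toℚ n' ℚ.* ½)
    components≡ = trans (sym (⟦⟧-components d m n)) (trans ⟦p⟧≡⟦q⟧ (⟦⟧-components d m' n'))
    undo-½ : ∀ x → x ≡ (x ℚ.* ½) ℚ.* toℚ (+ 2)
    undo-½ = solve 1 (λ x → x := (x :* con ½) :* con (toℚ (+ 2))) refl
    undo-+ : ∀ x y → x ≡ (x ℚ.+ y) ℚ.- y
    undo-+ = solve 2 (λ x y → x := (x :+ y) :- y) refl
    n≡n' : n ≡ n'
    n≡n' = toℚ-injective (begin
      toℚ n                           ≡⟨ undo-½ (toℚ n) ⟩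
      (toℚ n ℚ.* ½) ℚ.* toℚ (+ 2)     ≡⟨ cong (ℚ._* toℚ (+ 2)) (cong proj₂ components≡) ⟩
      (toℚ n' ℚ.* ½) ℚ.* toℚ (+ 2)    ≡⟨ undo-½ (toℚ n') ⟨
      toℚ n'                          ∎)
    m≡m' : m ≡ m'
    m≡m' = toℚ-injective (begin
      toℚ m                                                   ≡⟨ undo-+ (toℚ m) _ ⟩
      (toℚ m ℚ.+ toℚ n ℚ.* D ℚ.* ½) ℚ.- toℚ n ℚ.* D ℚ.* ½      ≡⟨ cong₂ ℚ._-_ (cong proj₁ components≡)
                                                                   (cong (λ t → toℚ t ℚ.* D ℚ.* ½) n≡n') ⟩
      (toℚ m' ℚ.+ toℚ n' ℚ.* D ℚ.* ½) ℚ.- toℚ n' ℚ.* D ℚ.* ½   ≡⟨ undo-+ (toℚ m') _ ⟨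
      toℚ m'                                                  ∎)

  ⟦Bézout⟧ : ∀ N x y z → ⟦ x * z + y * ι N ⟧ d ≡ mulK d (⟦ x ⟧ d) (⟦ z ⟧ d) +K mulK d (⟦ y ⟧ d) (intK N)
  ⟦Bézout⟧ N x y z = trans (⟦⟧-homo-+ (x * z) (y * ι N))
    (cong₂ _+K_ (⟦⟧-homo-* x z) (trans (⟦⟧-homo-* y (ι N)) (cong (mulK d (⟦ y ⟧ d)) (⟦ι⟧ N))))

  coprimeToN⇒invertibleMod : ∀ {N z} → CoprimeToN d N z → InvertibleMod (ι (+ N)) z
  coprimeToN⇒invertibleMod {N} {z} (x , y , eq) =
    x , y , ⟦⟧-injective (trans (⟦Bézout⟧ (+ N) x y z) (trans eq (sym (⟦ι⟧ (+ 1)))))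

  invertibleMod⇒coprimeToN : ∀ {N z} → InvertibleMod (ι (+ N)) z → CoprimeToN d N z
  invertibleMod⇒coprimeToN {N} {z} (x , y , eq) =
    x , y , trans (sym (⟦Bézout⟧ (+ N) x y z)) (trans (cong (λ t → ⟦ t ⟧ d) eq) (⟦ι⟧ (+ 1)))

  congModN : ∀ {N ρ σ τ} → ρ ≡ σ + ι (+ N) * τ → CongModN d N ρ σ
  congModN {N} {ρ} {σ} {τ} ρ≡σ+Nτ = τ , (begin
    ⟦ ρ ⟧ d                        ≡⟨ cong (λ t → ⟦ t ⟧ d) ρ≡σ+Nτ ⟩
    ⟦ σ + ι (+ N) * τ ⟧ d          ≡⟨ ⟦⟧-homo-+ σ (ι (+ N) * τ) ⟩
    ⟦ σ ⟧ d +K ⟦ ι (+ N) * τ ⟧ d   ≡⟨ cong (⟦ σ ⟧ d +K_) (⟦⟧-homo-* (ι (+ N)) τ) ⟩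
    ⟦ σ ⟧ d +K mulK d (⟦ ι (+ N) ⟧ d) (⟦ τ ⟧ d)
                                   ≡⟨ cong (λ t → ⟦ σ ⟧ d +K mulK d t (⟦ τ ⟧ d)) (⟦ι⟧ (+ N)) ⟩
    ⟦ σ ⟧ d +K mulK d (intK (+ N)) (⟦ τ ⟧ d) ∎)
    where open ≡-Reasoning

  isUnitOK-1# : IsUnitOK d 1#
  isUnitOK-1# = 1# , trans (sym (⟦⟧-homo-* 1# 1#)) (⟦ι⟧ (+ 1))

  ⟦⟧-homo-*³ : ∀ p q r → ⟦ (p * q) * r ⟧ d ≡ mulK d (mulK d (⟦ p ⟧ d) (⟦ q ⟧ d)) (⟦ r ⟧ d)
  ⟦⟧-homo-*³ p q r = trans (⟦⟧-homo-* (p * q) r) (cong (λ t → mulK d t (⟦ r ⟧ d)) (⟦⟧-homo-* p q))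

  -- ξ𝒪_K = ρ/σ · (α/β)𝒪_K with ρ = ξβ, σ = α and the unit 1.
  sameRayClass : ∀ {N ξ α β τ} → InvertibleMod (ι (+ N)) ξ → InvertibleMod (ι (+ N)) α →
                 InvertibleMod (ι (+ N)) β → ξ * β ≡ α + ι (+ N) * τ →
                 SameRayClass d N (⟦ ξ ⟧ d) α β
  sameRayClass {N} {ξ} {α} {β} {τ} ξ-inv α-inv β-inv ξβ≡α+Nτ =
    ξ * β , α , 1# ,
    invertibleMod⇒coprimeToN (invertibleMod-* ξ-inv β-inv) , invertibleMod⇒coprimeToN α-inv ,
    congModN {N} {ξ * β} {α} {τ} ξβ≡α+Nτ , isUnitOK-1# ,
    trans (sym (⟦⟧-homo-*³ ξ α β)) (trans (cong (λ t → ⟦ t ⟧ d) (rearrange ξ α β)) (⟦⟧-homo-*³ 1# (ξ * β) α))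
    where
    open ≡-Reasoning
    rearrange : ∀ ξ α β → (ξ * α) * β ≡ (1# * (ξ * β)) * α
    rearrange ξ α β = begin
      (ξ * α) * β        ≡⟨ *-assoc ξ α β ⟩
      ξ * (α * β)        ≡⟨ cong (ξ *_) (*-comm α β) ⟩
      ξ * (β * α)        ≡⟨ *-assoc ξ β α ⟨
      (ξ * β) * α        ≡⟨ cong (_* α) (*-identityˡ (ξ * β)) ⟨
      (1# * (ξ * β)) * α ∎

∃-normθ : ∀ {d} → FundamentalDiscriminant d → ∃[ k ] IsNormθ d k
∃-normθ {d} (inj₁ (4∣d-1 , _)) with ℤD.divides q d-1≡4q ← ℤD.∣ᵤ⇒∣ 4∣d-1 = q ℤ.* d , (begin
  + 4 ℤ.* (q ℤ.* d)     ≡⟨ ℤ-solve (q ∷ d ∷ []) ⟩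
  d ℤ.* (q ℤ.* + 4)     ≡⟨ cong (d ℤ.*_) d-1≡4q ⟨
  d ℤ.* (d ℤ.- + 1)     ≡⟨ ℤ-solve (d ∷ []) ⟩
  d ℤ.* d ℤ.- d         ∎)
  where open ≡-Reasoning
∃-normθ (inj₂ (m , refl , _)) = m ℤ.* (+ 4 ℤ.* m ℤ.- + 1) , ℤ-solve (m ∷ [])

even-or-odd : ∀ b → ∃[ q ] (b ≡ q ℤ.* + 2 ⊎ b ≡ + 1 ℤ.+ q ℤ.* + 2)
even-or-odd b with b ℤDM.%ℕ 2 | ℤDM.n%ℕd<d b 2 | ℤDM.a≡a%ℕn+[a/ℕn]*n b 2
... | 0 | _ | b≡r+2q = b ℤDM./ℕ 2 , inj₁ (trans b≡r+2q (ℤP.+-identityˡ _))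
... | 1 | _ | b≡r+2q = b ℤDM./ℕ 2 , inj₂ b≡r+2q
... | ℕ.suc (ℕ.suc _) | ℕ.s≤s (ℕ.s≤s ()) | _

-- b + d = b(b + 1) − 4ac is even.
∃-half[b+d] : ∀ a b c {d} → b ℤ.* b ℤ.- + 4 ℤ.* a ℤ.* c ≡ d → ∃[ h ] + 2 ℤ.* h ≡ b ℤ.+ d
∃-half[b+d] a b c refl with even-or-odd b
... | q , inj₁ refl = q ℤ.+ + 2 ℤ.* q ℤ.* q ℤ.- + 2 ℤ.* a ℤ.* c , 2h≡b+d q a c
  where
  2h≡b+d : ∀ q a c → + 2 ℤ.* (q ℤ.+ + 2 ℤ.* q ℤ.* q ℤ.- + 2 ℤ.* a ℤ.* c)
                   ≡ q ℤ.* + 2 ℤ.+ (q ℤ.* + 2 ℤ.* (q ℤ.* + 2) ℤ.- + 4 ℤ.* a ℤ.* c)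
  2h≡b+d = solve-∀
... | q , inj₂ refl = (+ 1 ℤ.+ + 2 ℤ.* q) ℤ.* (+ 1 ℤ.+ q) ℤ.- + 2 ℤ.* a ℤ.* c , 2h≡b+d q a c
  where
  2h≡b+d : ∀ q a c → + 2 ℤ.* ((+ 1 ℤ.+ + 2 ℤ.* q) ℤ.* (+ 1 ℤ.+ q) ℤ.- + 2 ℤ.* a ℤ.* c)
                   ≡ (+ 1 ℤ.+ q ℤ.* + 2) ℤ.+ ((+ 1 ℤ.+ q ℤ.* + 2) ℤ.* (+ 1 ℤ.+ q ℤ.* + 2) ℤ.- + 4 ℤ.* a ℤ.* c)
  2h≡b+d = solve-∀

-- Q(x, y) = a N(x − y ω_Q) and a ω_Q = θ − h.
Qform-norm : ∀ a b c {d k h} → b ℤ.* b ℤ.- + 4 ℤ.* a ℤ.* c ≡ d → IsNormθ d k → + 2 ℤ.* h ≡ b ℤ.+ d →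
             ∀ l₁ l₂ → Qform a b c (l₁ ℤ.+ l₂ ℤ.* h) (ℤ.- (a ℤ.* l₂)) ≡ a ℤ.* ℤ[θ].norm d k (l₁ , l₂)
Qform-norm a b c {d} {k} {h} disc 4k≡d²-d 2h≡b+d l₁ l₂ = begin
  Qform a b c (l₁ ℤ.+ l₂ ℤ.* h) (ℤ.- (a ℤ.* l₂))
    ≡⟨⟩
  a ℤ.* (l₁ ℤ.+ l₂ ℤ.* h) ℤ.* (l₁ ℤ.+ l₂ ℤ.* h) ℤ.+ b ℤ.* (l₁ ℤ.+ l₂ ℤ.* h) ℤ.* (ℤ.- (a ℤ.* l₂))
    ℤ.+ c ℤ.* (ℤ.- (a ℤ.* l₂)) ℤ.* (ℤ.- (a ℤ.* l₂))
    ≡⟨ ℤ-solve (a ∷ b ∷ c ∷ h ∷ l₁ ∷ l₂ ∷ []) ⟩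
  a ℤ.* (l₁ ℤ.* l₁ ℤ.+ l₁ ℤ.* l₂ ℤ.* (+ 2 ℤ.* h ℤ.- b) ℤ.+ l₂ ℤ.* l₂ ℤ.* (h ℤ.* h ℤ.- b ℤ.* h ℤ.+ a ℤ.* c))
    ≡⟨ cong₂ (λ x y → a ℤ.* (l₁ ℤ.* l₁ ℤ.+ l₁ ℤ.* l₂ ℤ.* x ℤ.+ l₂ ℤ.* l₂ ℤ.* y)) trace≡d norm≡k ⟩
  a ℤ.* ℤ[θ].norm d k (l₁ , l₂) ∎
  where
  open ≡-Reasoning
  trace≡d : + 2 ℤ.* h ℤ.- b ≡ d
  trace≡d = trans (cong (ℤ._- b) 2h≡b+d) (cancel b d)
    where
    cancel : ∀ b d → b ℤ.+ d ℤ.- b ≡ d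
    cancel = solve-∀
  norm≡k : h ℤ.* h ℤ.- b ℤ.* h ℤ.+ a ℤ.* c ≡ k
  norm≡k = ℤP.*-cancelˡ-≡ (+ 4) _ _ (begin
    + 4 ℤ.* (h ℤ.* h ℤ.- b ℤ.* h ℤ.+ a ℤ.* c)
      ≡⟨ ℤ-solve (h ∷ b ∷ a ∷ c ∷ []) ⟩
    (+ 2 ℤ.* h) ℤ.* (+ 2 ℤ.* h) ℤ.- + 2 ℤ.* b ℤ.* (+ 2 ℤ.* h) ℤ.+ + 4 ℤ.* a ℤ.* c
      ≡⟨ cong (λ x → x ℤ.* x ℤ.- + 2 ℤ.* b ℤ.* x ℤ.+ + 4 ℤ.* a ℤ.* c) 2h≡b+d ⟩
    (b ℤ.+ d) ℤ.* (b ℤ.+ d) ℤ.- + 2 ℤ.* b ℤ.* (b ℤ.+ d) ℤ.+ + 4 ℤ.* a ℤ.* c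
      ≡⟨ ℤ-solve (b ∷ d ∷ a ∷ c ∷ []) ⟩
    d ℤ.* d ℤ.- (b ℤ.* b ℤ.- + 4 ℤ.* a ℤ.* c)
      ≡⟨ cong (λ x → d ℤ.* d ℤ.- x) disc ⟩
    d ℤ.* d ℤ.- d
      ≡⟨ 4k≡d²-d ⟨
    + 4 ℤ.* k ∎)

toℚ[h] : ∀ b d {h} → + 2 ℤ.* h ≡ b ℤ.+ d → toℚ h ≡ (toℚ b ℚ.+ toℚ d) ℚ.* ½
toℚ[h] b d {h} 2h≡b+d = begin
  toℚ h                            ≡⟨ solve 1 (λ x → x := (con (toℚ (+ 2)) :* x) :* con ½) refl (toℚ h) ⟩
  (toℚ (+ 2) ℚ.* toℚ h) ℚ.* ½      ≡⟨ cong (ℚ._* ½) (toℚ-homo-* (+ 2) h) ⟨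
  toℚ (+ 2 ℤ.* h) ℚ.* ½            ≡⟨ cong (λ t → toℚ t ℚ.* ½) 2h≡b+d ⟩
  toℚ (b ℤ.+ d) ℚ.* ½              ≡⟨ cong (ℚ._* ½) (toℚ-homo-+ b d) ⟩
  (toℚ b ℚ.+ toℚ d) ℚ.* ½          ∎
  where
  open ≡-Reasoning
  open ℚ-Solver using (solve; _:*_; _:=_; con)

-- a ω_Q = θ − h
uωQ+v≡⟦⟧ : ∀ d b {h} n l₁ l₂ → + 2 ℤ.* h ≡ b ℤ.+ d →
           mulK d (intK (+ ℕ.suc n ℤ.* l₂)) (ωQ (+ ℕ.suc n) b) +K intK (l₁ ℤ.+ l₂ ℤ.* h) ≡ ⟦ l₁ , l₂ ⟧ d
uωQ+v≡⟦⟧ d b {h} n l₁ l₂ 2h≡b+d = trans (cong₂ _,_ first second) (sym (⟦⟧-components d l₁ l₂))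
  where
  open ≡-Reasoning
  open ℚ-Solver using (solve; _:+_; _:*_; _:=_; con; :-_)
  a : ℤ
  a = + ℕ.suc n
  A r B D L₁ L₂ H : ℚ
  A = toℚ a ; r = recipℤ (+ 2 ℤ.* a) ; B = toℚ b ; D = toℚ d ; L₁ = toℚ l₁ ; L₂ = toℚ l₂ ; H = toℚ h
  toℚ[u] : toℚ (a ℤ.* l₂) ≡ A ℚ.* L₂
  toℚ[u] = toℚ-homo-* a l₂
  toℚ[v] : toℚ (l₁ ℤ.+ l₂ ℤ.* h) ≡ L₁ ℚ.+ L₂ ℚ.* H
  toℚ[v] = trans (toℚ-homo-+ l₁ (l₂ ℤ.* h)) (cong (L₁ ℚ.+_) (toℚ-homo-* l₂ h))
  first : toℚ (a ℤ.* l₂) ℚ.* (toℚ (ℤ.- b) ℚ.* r) ℚ.+ D ℚ.* 0ℚ ℚ.* r ℚ.+ toℚ (l₁ ℤ.+ l₂ ℤ.* h)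
          ≡ L₁ ℚ.+ L₂ ℚ.* D ℚ.* ½
  first = begin
    toℚ (a ℤ.* l₂) ℚ.* (toℚ (ℤ.- b) ℚ.* r) ℚ.+ D ℚ.* 0ℚ ℚ.* r ℚ.+ toℚ (l₁ ℤ.+ l₂ ℤ.* h)
      ≡⟨ cong₃ toℚ[u] (toℚ-homo‿- b) toℚ[v] ⟩
    (A ℚ.* L₂) ℚ.* ((ℚ.- B) ℚ.* r) ℚ.+ D ℚ.* 0ℚ ℚ.* r ℚ.+ (L₁ ℚ.+ L₂ ℚ.* H)
      ≡⟨ solve 7 (λ A L₂ B r D L₁ H → (A :* L₂) :* ((:- B) :* r) :+ D :* con 0ℚ :* r :+ (L₁ :+ L₂ :* H)
                                    := (L₂ :* (:- B)) :* (A :* r) :+ L₁ :+ L₂ :* H) refl A L₂ B r D L₁ H ⟩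
    (L₂ ℚ.* (ℚ.- B)) ℚ.* (A ℚ.* r) ℚ.+ L₁ ℚ.+ L₂ ℚ.* H
      ≡⟨ cong₂ (λ x y → (L₂ ℚ.* (ℚ.- B)) ℚ.* x ℚ.+ L₁ ℚ.+ L₂ ℚ.* y) (toℚ[a]*recip[2a]≡½ n) (toℚ[h] b d 2h≡b+d) ⟩
    (L₂ ℚ.* (ℚ.- B)) ℚ.* ½ ℚ.+ L₁ ℚ.+ L₂ ℚ.* ((B ℚ.+ D) ℚ.* ½)
      ≡⟨ solve 4 (λ L₂ B L₁ D → (L₂ :* (:- B)) :* con ½ :+ L₁ :+ L₂ :* ((B :+ D) :* con ½)
                             := L₁ :+ L₂ :* D :* con ½) refl L₂ B L₁ D ⟩
    L₁ ℚ.+ L₂ ℚ.* D ℚ.* ½ ∎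
    where
    cong₃ : ∀ {x x' y y' z z'} → x ≡ x' → y ≡ y' → z ≡ z' →
            x ℚ.* (y ℚ.* r) ℚ.+ D ℚ.* 0ℚ ℚ.* r ℚ.+ z ≡ x' ℚ.* (y' ℚ.* r) ℚ.+ D ℚ.* 0ℚ ℚ.* r ℚ.+ z'
    cong₃ refl refl refl = refl
  second : toℚ (a ℤ.* l₂) ℚ.* r ℚ.+ 0ℚ ℚ.* (toℚ (ℤ.- b) ℚ.* r) ℚ.+ 0ℚ ≡ L₂ ℚ.* ½
  second = begin
    toℚ (a ℤ.* l₂) ℚ.* r ℚ.+ 0ℚ ℚ.* (toℚ (ℤ.- b) ℚ.* r) ℚ.+ 0ℚ
      ≡⟨ cong (λ x → x ℚ.* r ℚ.+ 0ℚ ℚ.* (toℚ (ℤ.- b) ℚ.* r) ℚ.+ 0ℚ) toℚ[u] ⟩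
    (A ℚ.* L₂) ℚ.* r ℚ.+ 0ℚ ℚ.* (toℚ (ℤ.- b) ℚ.* r) ℚ.+ 0ℚ
      ≡⟨ solve 4 (λ A L₂ r W → (A :* L₂) :* r :+ con 0ℚ :* (W :* r) :+ con 0ℚ := L₂ :* (A :* r)) refl A L₂ r (toℚ (ℤ.- b)) ⟩
    L₂ ℚ.* (A ℚ.* r)
      ≡⟨ cong (L₂ ℚ.*_) (toℚ[a]*recip[2a]≡½ n) ⟩
    L₂ ℚ.* ½ ∎

lemma4p2 : (d : ℤ) → FundamentalDiscriminant d → d ℤ.< ℤ.0ℤ
         → d ≢ ℤ.- (+ 4) → d ≢ ℤ.- (+ 3)
         → (N : ℕ) → 1 ℕ.≤ N
         → (a b c : ℤ) → InQN N d a b c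
         → (α β : OK) → CoprimeToN d N α → CoprimeToN d N β
         → ∃[ u ] ∃[ v ]
             (gcd (+ N) (Qform a b c v (ℤ.- u)) ≡ + 1)
             × SameRayClass d N (mulK d (intK u) (ωQ a b) +K intK v) α β
lemma4p2 d fd _ _ _ N _ (+ ℕ.suc n) b c (_ , _ , _ , disc , gcd[N,a]≡1) α β α-cop β-cop
  with k , 4k≡d²-d ← ∃-normθ fd
     | h , 2h≡b+d ← ∃-half[b+d] (+ ℕ.suc n) b c disc
  = let (l₁ , l₂) , ξ-inv , τ , ξβ≡α+Nτ = quotientMod α-inv β-inv in
    a ℤ.* l₂ , l₁ ℤ.+ l₂ ℤ.* h ,
    trans (cong (gcd (+ N)) (Qform-norm a b c disc 4k≡d²-d 2h≡b+d l₁ l₂))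
      (coprime⇒gcd≡1 (+ N) (a ℤ.* norm (l₁ , l₂))
        (coprime-* (+ N) a (norm (l₁ , l₂)) (gcd≡1⇒coprime (+ N) a gcd[N,a]≡1) (invertibleMod⇒coprime-norm ξ-inv))) ,
    subst (λ μ → SameRayClass d N μ α β) (sym (uωQ+v≡⟦⟧ d b n l₁ l₂ 2h≡b+d))
      (sameRayClass ξ-inv α-inv β-inv ξβ≡α+Nτ)
  where
  open ℤ[θ] d k
  open Residues d k
  open Embedding d k 4k≡d²-d
  a : ℤ
  a = + ℕ.suc n
  α-inv : InvertibleMod (ι (+ N)) α
  α-inv = coprimeToN⇒invertibleMod α-cop
  β-inv : InvertibleMod (ι (+ N)) β
  β-inv = coprimeToN⇒invertibleMod β-cop
lemma4p2 _ _ _ _ _ _ _ (+ 0) _ _ (_ , ℤ.+<+ () , _) _ _ _ _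
lemma4p2 _ _ _ _ _ _ _ -[1+ _ ] _ _ (_ , () , _) _ _ _ _
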